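{- For each $t\in\{11,1211,122,211,2122,22\}$ there is no $I(5,4)$ admissible set all of whose elements are of type $t$. For each $t\in\{1212,2121\}$ there is no $I(6,4)$ admissible set all of whose elements are of type $t$.
   Context: $[m]=\{1,\dots,m\}$. For $v\in\{0,1,2\}^m$, $\mathrm{Supp}\, v=\{i: v_i\neq0\}$; $V_S$ is the set of vectors in $\{0,1,2\}^m$ with support exactly $S$. A subset of $\{0,1,2\}^m$ is $I(m,w)$ if it contains exactly one element of $V_S$ for each $S\subseteq[m]$ with $|S|=w$ and no other elements. Two vectors form a clash if the support of one is contained in that of the other; three vectors $v_1,v_2,v_3$ form a clash if there is no coordinate at which exactly one of them is non-zero and no coordinate at which their three values are pairwise distinct. A set is admissible if it contains no clash (of two distinct or three distinct elements). A string $t$ such as $1211$ denotes the vector $(1,2,1,1)\in\{1,2\}^4$. A vector $v$ is of type $t\in\{1,2\}^k$ if it has at least $k$ non-zero coordinates and for each $i\le k$ its $i$-th non-zero coordinate (in increasing index order) equals $t_i$. -}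

module Defs where

open import Data.Nat using (ℕ)
open import Data.Bool using (Bool; true; false)
open import Data.Fin using (Fin; zero; suc)
open import Data.Fin.Subset using (Subset; _⊆_; ∣_∣)
open import Data.Vec using (Vec; map; lookup; toList)
open import Data.List using (List; []; _∷_; _++_; filter)
open import Data.Product using (Σ; ∃; _×_; _,_)
open import Data.Empty using (⊥)
open import Data.Sum using (_⊎_)
open import Data.Bool.Properties using (T?)
open import Relation.Nullary using (¬_; yes; no)
open import Relation.Binary.PropositionalEquality using (_≡_; _≢_)

Tri : Set
Tri = Fin 3

zeroT oneT twoT : Tri
zeroT = zero
oneT = suc zero
twoT = suc (suc zero)

Vect : ℕ → Set
Vect m = Vec Tri m

VSet : ℕ → Set
VSet m = Vect m → Bool

_∈ˢ_ : ∀ {m} → Vect m → VSet m → Set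
v ∈ˢ A = A v ≡ true

isNz : Tri → Bool
isNz zero = false
isNz (suc _) = true

Supp : ∀ {m} → Vect m → Subset m
Supp v = map isNz v

IsI : (m w : ℕ) → VSet m → Set
IsI m w A =
  ((S : Subset m) → ∣ S ∣ ≡ w →
     Σ (Vect m) λ v → v ∈ˢ A × Supp v ≡ S ×
       ((u : Vect m) → u ∈ˢ A → Supp u ≡ S → u ≡ v))
  × ((v : Vect m) → v ∈ˢ A → ∣ Supp v ∣ ≡ w)

Clash2 : ∀ {m} → Vect m → Vect m → Set
Clash2 u v = (Supp u ⊆ Supp v) ⊎ (Supp v ⊆ Supp u)

ExactlyOneNz : Tri → Tri → Tri → Set
ExactlyOneNz a b c =
  (isNz a ≡ true × isNz b ≡ false × isNz c ≡ false)
  ⊎ (isNz a ≡ false × isNz b ≡ true × isNz c ≡ false)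
  ⊎ (isNz a ≡ false × isNz b ≡ false × isNz c ≡ true)

PairwiseDistinct : Tri → Tri → Tri → Set
PairwiseDistinct a b c = a ≢ b × b ≢ c × a ≢ c

Clash3 : ∀ {m} → Vect m → Vect m → Vect m → Set
Clash3 {m} u v w =
  ((i : Fin m) → ¬ ExactlyOneNz (lookup u i) (lookup v i) (lookup w i))
  × ((i : Fin m) → ¬ PairwiseDistinct (lookup u i) (lookup v i) (lookup w i))

Admissible : ∀ {m} → VSet m → Set
Admissible {m} A =
  ((u v : Vect m) → u ∈ˢ A → v ∈ˢ A → u ≢ v → ¬ Clash2 u v)
  × ((u v w : Vect m) → u ∈ˢ A → v ∈ˢ A → w ∈ˢ A →
       u ≢ v → v ≢ w → u ≢ w → ¬ Clash3 u v w)

nonzeros : ∀ {m} → Vect m → List Tri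
nonzeros v = filter (λ x → T? (isNz x)) (toList v)

-- v is of type t (t a word over {1,2}): t is a prefix of the list of
-- non-zero coordinates of v (so v has at least |t| non-zero coordinates).
OfType : ∀ {m} → List Tri → Vect m → Set
OfType t v = Σ (List Tri) λ rest → t ++ rest ≡ nonzeros v

AllOfType : ∀ {m} → List Tri → VSet m → Set
AllOfType {m} t A = (v : Vect m) → v ∈ˢ A → OfType t v

t11 t1211 t122 t211 t2122 t22 t1212 t2121 : List Tri
t11 = oneT ∷ oneT ∷ []
t1211 = oneT ∷ twoT ∷ oneT ∷ oneT ∷ []
t122 = oneT ∷ twoT ∷ twoT ∷ []
t211 = twoT ∷ oneT ∷ oneT ∷ []
t2122 = twoT ∷ oneT ∷ twoT ∷ twoT ∷ []
t22 = twoT ∷ twoT ∷ []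
t1212 = oneT ∷ twoT ∷ oneT ∷ twoT ∷ []
t2121 = twoT ∷ oneT ∷ twoT ∷ oneT ∷ []

NoAdmissibleOfType : ℕ → ℕ → List Tri → Set
NoAdmissibleOfType m w t =
  (A : VSet m) → IsI m w A → Admissible A → AllOfType t A → ⊥

{-# OPTIONS --safe #-}
-- In an I(m,w) set all of whose elements have type t, the element with support S is one of the
-- finitely many vectors of type t with support S, so the set picks one such candidate for each
-- w-subset S. For each of the eight cases an exhaustive search shows that every such choice contains
-- three distinct vectors forming a clash, which admissibility forbids.
module Submission where

open import Defs
open import Data.List using (_∷_; [])
open import Data.List.Relation.Unary.All using (All)
open import Data.Product using (_×_)

open import Data.Bool using (true; false)
import Data.Bool.Properties as Bool
open import Data.Fin.Properties using (all?) renaming (_≟_ to _≟ᶠ_)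
open import Data.Fin.Subset using (Subset; ∣_∣)
open import Data.List using (List; [_]; _++_; map; filter; allFin; cartesianProductWith)
open import Data.List.Membership.Propositional using (_∈_; find; lose)
open import Data.List.Membership.Propositional.Properties using (∈-allFin; ∈-filter⁺; ∈-cartesianProductWith⁺)
open import Data.List.Relation.Binary.Pointwise using (≡⇒Pointwise-≡)
open import Data.List.Relation.Binary.Prefix.Heterogeneous using (Prefix; _++ᵖ_)
open import Data.List.Relation.Binary.Prefix.Heterogeneous.Properties using (fromPointwise; prefix?)
open import Data.List.Relation.Unary.All using ([]; _∷_; lookupAny)
open import Data.List.Relation.Unary.All.Properties using (all-filter; map⁺; ++⁺)
import Data.List.Relation.Unary.All as All
open import Data.List.Relation.Unary.Any using (Any; here; any?)
open import Data.Nat using (ℕ; zero; suc) renaming (_≟_ to _≟ⁿ_)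
open import Data.Product using (_,_)
open import Data.Vec using (Vec; []; _∷_)
open import Data.Vec.Properties using (≡-dec)
open import Relation.Nullary using (Dec; ¬_; ¬?)
open import Relation.Nullary.Decidable using (True; toWitness; _×-dec_; _⊎-dec_)
open import Relation.Binary.PropositionalEquality using (_≡_; _≢_; refl; subst)

vecs : ∀ {a} {A : Set a} → List A → (n : ℕ) → List (Vec A n)
vecs xs zero    = [ [] ]
vecs xs (suc n) = cartesianProductWith _∷_ xs (vecs xs n)

∈-vecs : ∀ {a} {A : Set a} {xs : List A} → (∀ x → x ∈ xs) → ∀ {n} (v : Vec A n) → v ∈ vecs xs n
∈-vecs complete []      = here refl
∈-vecs complete (x ∷ v) = ∈-cartesianProductWith⁺ _∷_ (complete x) (∈-vecs complete v)

choices : ∀ {a} {A : Set a} → List (List A) → List (List A)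
choices []         = [ [] ]
choices (xs ∷ xss) = cartesianProductWith _∷_ xs (choices xss)

any-choices : ∀ {a p} {A : Set a} {P : A → Set p} {xss : List (List A)} →
              All (Any P) xss → Any (All P) (choices xss)
any-choices []           = here []
any-choices (px ∷ pxss) with find px | find (any-choices pxss)
... | _ , x∈xs , Px | _ , ys∈choices , Pys =
  lose (∈-cartesianProductWith⁺ _∷_ x∈xs ys∈choices) (Px ∷ Pys)

pairs : ∀ {a} {A : Set a} → List A → List (A × A)
pairs []       = []
pairs (x ∷ xs) = map (x ,_) xs ++ pairs xs

triples : ∀ {a} {A : Set a} → List A → List (A × A × A)
triples []       = []
triples (x ∷ xs) = map (x ,_) (pairs xs) ++ triples xs

pairs⁺ : ∀ {a p} {A : Set a} {P : A → Set p} {xs : List A} →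
         All P xs → All (λ (x , y) → P x × P y) (pairs xs)
pairs⁺ []         = []
pairs⁺ (px ∷ pxs) = ++⁺ (map⁺ (All.map (px ,_) pxs)) (pairs⁺ pxs)

triples⁺ : ∀ {a p} {A : Set a} {P : A → Set p} {xs : List A} →
           All P xs → All (λ (x , y , z) → P x × P y × P z) (triples xs)
triples⁺ []         = []
triples⁺ (px ∷ pxs) = ++⁺ (map⁺ (All.map (px ,_) (pairs⁺ pxs))) (triples⁺ pxs)

ofType⇒prefix : ∀ {m} {t : List Tri} {v : Vect m} → OfType t v → Prefix _≡_ t (nonzeros v)
ofType⇒prefix {t = t} (rest , t++rest≡nz) =
  subst (Prefix _≡_ t) t++rest≡nz (fromPointwise (≡⇒Pointwise-≡ refl) ++ᵖ rest)

candidates : ∀ {m} → List Tri → Subset m → List (Vect m)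
candidates t S =
  filter (λ v → ≡-dec Bool._≟_ (Supp v) S ×-dec prefix? _≟ᶠ_ t (nonzeros v)) (vecs (allFin 3) _)

∈-candidates : ∀ {m} {t : List Tri} {S : Subset m} {v : Vect m} →
               Supp v ≡ S → OfType t v → v ∈ candidates t S
∈-candidates {v = v} supp ofType = ∈-filter⁺ _ (∈-vecs ∈-allFin v) (supp , ofType⇒prefix {v = v} ofType)

supportsOfSize : (m w : ℕ) → List (Subset m)
supportsOfSize m w = filter (λ S → ∣ S ∣ ≟ⁿ w) (vecs (true ∷ false ∷ []) m)

DistinctClash : ∀ {m} → Vect m × Vect m × Vect m → Set
DistinctClash (u , v , w) = Clash3 u v w × (u ≢ v × v ≢ w × u ≢ w)

ClashingTriple : ∀ {m} → List (Vect m) → Set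
ClashingTriple xs = Any DistinctClash (triples xs)

exactlyOneNz? : ∀ a b c → Dec (ExactlyOneNz a b c)
exactlyOneNz? a b c =
  (isNz a Bool.≟ true  ×-dec isNz b Bool.≟ false ×-dec isNz c Bool.≟ false) ⊎-dec
  (isNz a Bool.≟ false ×-dec isNz b Bool.≟ true  ×-dec isNz c Bool.≟ false) ⊎-dec
  (isNz a Bool.≟ false ×-dec isNz b Bool.≟ false ×-dec isNz c Bool.≟ true)

pairwiseDistinct? : ∀ a b c → Dec (PairwiseDistinct a b c)
pairwiseDistinct? a b c = ¬? (a ≟ᶠ b) ×-dec ¬? (b ≟ᶠ c) ×-dec ¬? (a ≟ᶠ c)

clash3? : ∀ {m} (u v w : Vect m) → Dec (Clash3 u v w)
clash3? u v w = all? (λ i → ¬? (exactlyOneNz? _ _ _)) ×-dec all? (λ i → ¬? (pairwiseDistinct? _ _ _))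

-- Testing the clash before distinctness makes the search several times faster.
distinctClash? : ∀ {m} (uvw : Vect m × Vect m × Vect m) → Dec (DistinctClash uvw)
distinctClash? (u , v , w) = clash3? u v w ×-dec (¬? (u ≟ᵛ v) ×-dec ¬? (v ≟ᵛ w) ×-dec ¬? (u ≟ᵛ w))
  where _≟ᵛ_ = ≡-dec _≟ᶠ_

clashingTriple? : ∀ {m} (xs : List (Vect m)) → Dec (ClashingTriple xs)
clashingTriple? xs = any? distinctClash? (triples xs)

module _ {m : ℕ} {A : VSet m} where

  admissible⇒¬clashingTriple : Admissible A → {xs : List (Vect m)} → All (_∈ˢ A) xs → ¬ ClashingTriple xs
  admissible⇒¬clashingTriple (_ , noClash3) xs⊆A clashing
    with (u∈A , v∈A , w∈A) , (clash , u≢v , v≢w , u≢w) ← lookupAny (triples⁺ xs⊆A) clashing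
    = noClash3 _ _ _ u∈A v∈A w∈A u≢v v≢w u≢w clash

  some-choice⊆ : ∀ {w t} → IsI m w A → AllOfType t A →
                 Any (All (_∈ˢ A)) (choices (map (candidates t) (supportsOfSize m w)))
  some-choice⊆ {w} {t} (oneForEach , _) ofType =
    any-choices (map⁺ (All.map member (all-filter (λ S → ∣ S ∣ ≟ⁿ w) (vecs (true ∷ false ∷ []) m))))
    where
    member : ∀ {S} → ∣ S ∣ ≡ w → Any (_∈ˢ A) (candidates t S)
    member {S} |S|≡w =
      let v , v∈A , suppv≡S , _ = oneForEach S |S|≡w
      in lose (∈-candidates suppv≡S (ofType v v∈A)) v∈A

EveryChoiceClashes : (m w : ℕ) → List Tri → Set
EveryChoiceClashes m w t = All ClashingTriple (choices (map (candidates t) (supportsOfSize m w)))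

everyChoiceClashes? : ∀ m w t → Dec (EveryChoiceClashes m w t)
everyChoiceClashes? m w t = All.all? clashingTriple? _

everyChoiceClashes⇒noAdmissible : ∀ {m w t} → EveryChoiceClashes m w t → NoAdmissibleOfType m w t
everyChoiceClashes⇒noAdmissible clashes A isI adm ofType =
  let clash , choice⊆A = lookupAny clashes (some-choice⊆ isI ofType)
  in admissible⇒¬clashingTriple adm choice⊆A clash

corollary5 : All (NoAdmissibleOfType 5 4) (t11 ∷ t1211 ∷ t122 ∷ t211 ∷ t2122 ∷ t22 ∷ [])
           × All (NoAdmissibleOfType 6 4) (t1212 ∷ t2121 ∷ [])
corollary5 = (bySearch ∷ bySearch ∷ bySearch ∷ bySearch ∷ bySearch ∷ bySearch ∷ [])
           , (bySearch ∷ bySearch ∷ [])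
  where
  bySearch : ∀ {m w t} {found : True (everyChoiceClashes? m w t)} → NoAdmissibleOfType m w t
  bySearch {found = found} = everyChoiceClashes⇒noAdmissible (toWitness found)
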